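{- Let $\mathcal{L}_1=(S_1,\iota_1,\rightarrow_1)$ and $\mathcal{L}_2=(S_2,\iota_2,\rightarrow_2)$ be two LTSs with finitely many states. Then: (i) $\textsc{Refines}_{\mathsf{tr}}(\mathcal{L}_1,\mathcal{L}_2)$ returns true if and only if $\mathcal{L}_1\sqsubseteq_{\mathsf{tr}}\mathcal{L}_2$; (ii) $\textsc{Refines}_{\mathsf{sfr}}(\mathcal{L}_1,\mathcal{L}_2)$ returns true if and only if $\mathcal{L}_1\sqsubseteq_{\mathsf{sfr}}\mathcal{L}_2$; (iii) $\textsc{Refines}_{\mathsf{fdr}}(\mathcal{L}_1,\mathcal{L}_2)$ returns true if and only if $\mathcal{L}_1\sqsubseteq_{\mathsf{fdr}}\mathcal{L}_2$.
   Context: Fix a finite set $\mathit{Act}$ of actions not containing the internal action $\tau$; $\mathit{Act}_\tau=\mathit{Act}\cup\{\tau\}$. An LTS is $(S,\iota,\rightarrow)$ with $\iota\in S$ and $\rightarrow\subseteq S\times\mathit{Act}_\tau\times S$; $\mathsf{enabled}(s)=\{a\in\mathit{Act}_\tau\mid\exists t: s\xrightarrow{a}t\}$. The weak transition relation $\Longrightarrow\subseteq S\times\mathit{Act}^*\times S$ is the smallest relation with $s\overset{\epsilon}{\Longrightarrow}s$; $s\overset{\epsilon}{\Longrightarrow}t$ if $s\xrightarrow{\tau}t$; $s\overset{a}{\Longrightarrow}t$ if $s\xrightarrow{a}t$ ($a\in\mathit{Act}$); $s\overset{\rho\sigma}{\Longrightarrow}t$ if $s\overset{\rho}{\Longrightarrow}u\overset{\sigma}{\Longrightarrow}t$.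 $\mathsf{weaktraces}(\mathcal{L})=\{\rho\in\mathit{Act}^*\mid\exists t:\iota\overset{\rho}{\Longrightarrow}t\}$. A state $s$ is stable if $\tau\notin\mathsf{enabled}(s)$; for stable $s$, $\mathsf{refusals}(s)=\mathcal{P}(\mathit{Act}\setminus\mathsf{enabled}(s))$; for a set $U$ of states, $\mathsf{refusals}(U)=\{X\subseteq\mathit{Act}\mid\exists s\in U: s\text{ stable}\wedge X\in\mathsf{refusals}(s)\}$. A state $s$ diverges if there is an infinite sequence $s\xrightarrow{\tau}s_1\xrightarrow{\tau}s_2\xrightarrow{\tau}\cdots$; a set diverges if one of its states does. $\mathsf{divergences}(\mathcal{L})=\{\rho\sigma\in\mathit{Act}^*\mid\exists t:\iota\overset{\rho}{\Longrightarrow}t\wedge t\text{ diverges}\}$; $\mathsf{failures}(\mathcal{L})=\{(\rho,X)\in\mathit{Act}^*\times\mathcal{P}(\mathit{Act})\mid\exists t:\iota\overset{\rho}{\Longrightarrow}t,\ t\text{ stable},\ X\in\mathsf{refusals}(t)\}$; $\mathsf{failures}_\bot(\mathcal{L})=\mathsf{failures}(\mathcal{L})\cup\{(\rho,X)\mid\rho\in\mathsf{divergences}(\mathcal{L}),X\subseteq\mathit{Act}\}$. Refinements: $\mathcal{L}_1\sqsubseteq_{\mathsf{tr}}\mathcal{L}_2$ iff $\mathsf{weaktraces}(\mathcal{L}_2)\subseteq\mathsf{weaktraces}(\mathcal{L}_1)$; $\mathcal{L}_1\sqsubseteq_{\mathsf{sfr}}\mathcal{L}_2$ iff $\mathsf{failures}(\mathcal{L}_2)\subseteq\mathsf{failures}(\mathcal{L}_1)$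 and $\mathsf{weaktraces}(\mathcal{L}_2)\subseteq\mathsf{weaktraces}(\mathcal{L}_1)$; $\mathcal{L}_1\sqsubseteq_{\mathsf{fdr}}\mathcal{L}_2$ iff $\mathsf{failures}_\bot(\mathcal{L}_2)\subseteq\mathsf{failures}_\bot(\mathcal{L}_1)$ and $\mathsf{divergences}(\mathcal{L}_2)\subseteq\mathsf{divergences}(\mathcal{L}_1)$. Antichain notation on pairs $(U,s)\in\mathcal{P}(S_1)\times S_2$: order $(U,s)\leq(V,t)$ iff $s=t$ and $U\subseteq V$; for a set $\mathcal{A}$ of pairs, $x\Subset\mathcal{A}$ iff some $y\in\mathcal{A}$ has $y\leq x$; $\mathcal{A}\Cup x=\{z\mid z=x\vee(z\in\mathcal{A}\wedge x\not\leq z)\}$. The algorithms: let $I=(\{s\in S_1\mid\iota_1\overset{\epsilon}{\Longrightarrow}_1s\},\iota_2)$. Initialise a stack $\mathit{working}$ containing only $I$ and $\mathit{antichain}:=\{I\}$. While $\mathit{working}$ is nonempty: pop $(\mathit{spec},\mathit{impl})$ from $\mathit{working}$; perform the variant-specific checks (below); then, unless skipped, for each transition $\mathit{impl}\xrightarrow{a}_2\mathit{impl}'$: let $\mathit{spec}'=\mathit{spec}$ if $a=\tau$ and $\mathit{spec}'=\{s'\in S_1\mid\exists s\in\mathit{spec}: s\overset{a}{\Longrightarrow}_1s'\}$ otherwise; if $\mathit{spec}'=\emptyset$ return false; if $(\mathit{spec}',\mathit{impl}')\not\Subset\mathit{antichain}$ then set $\mathit{antichain}:=\mathit{antichain}\Cup(\mathit{spec}',\mathit{impl}')$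 and push $(\mathit{spec}',\mathit{impl}')$ onto $\mathit{working}$. When $\mathit{working}$ becomes empty, return true. Variant checks: $\textsc{Refines}_{\mathsf{tr}}$ performs no checks. $\textsc{Refines}_{\mathsf{sfr}}$: if $\mathit{impl}$ is stable and $\mathsf{refusals}(\mathit{impl})\not\subseteq\mathsf{refusals}(\mathit{spec})$, return false. $\textsc{Refines}_{\mathsf{fdr}}$: if $\mathit{spec}$ diverges, skip the for-loop for this pair (continue with the next iteration); otherwise, if $\mathit{impl}$ diverges return false, and if $\mathit{impl}$ is stable and $\mathsf{refusals}(\mathit{impl})\not\subseteq\mathsf{refusals}(\mathit{spec})$ return false, then execute the for-loop. -}

module Defs where

open import Data.Nat using (ℕ; zero; suc)
open import Data.Bool using (Bool; true; false; T)
open import Data.Fin using (Fin)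
open import Data.Fin.Properties using (_≟_)
open import Data.Fin.Subset using (Subset; _∈_; _⊆_) renaming (⊥ to ∅)
open import Data.Fin.Subset.Properties using (_⊆?_)
open import Data.List using (List; []; _∷_; _++_; filter)
open import Data.List.Relation.Unary.Any using (Any)
open import Data.List.Relation.Unary.Unique.Propositional using (Unique)
import Data.List.Membership.Propositional as LM
open import Data.Product using (Σ; ∃; _×_; _,_; proj₁; proj₂)
open import Relation.Binary.PropositionalEquality using (_≡_)
open import Relation.Nullary using (¬_; Dec)
open import Relation.Nullary.Decidable using (_×-dec_; ¬?)
open import Function.Bundles using (_⇔_)

data Actτ (k : ℕ) : Set where
  τ   : Actτ k
  act : Fin k → Actτ k

-- LTS with finitely many states (S = Fin n).  The transition relation
-- is a subset of S × Act_τ × S, given by its characteristic function.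

record LTS (k : ℕ) : Set where
  field
    n : ℕ
    ι : Fin n
    δ : Fin n → Actτ k → Fin n → Bool

module _ {k : ℕ} (L : LTS k) where
  open LTS L

  State : Set
  State = Fin n

  _—[_]→_ : State → Actτ k → State → Set
  s —[ a ]→ t = T (δ s a t)

  Enabled : State → Actτ k → Set
  Enabled s a = ∃ λ t → s —[ a ]→ t

  data _⟹[_]_ : State → List (Fin k) → State → Set where
    ε-refl : ∀ {s} → s ⟹[ [] ] s
    ε-τ    : ∀ {s t} → s —[ τ ]→ t → s ⟹[ [] ] t
    vis    : ∀ {s t a} → s —[ act a ]→ t → s ⟹[ a ∷ [] ] t
    cat    : ∀ {s u t ρ σ} → s ⟹[ ρ ]  u → u ⟹[ σ ] t → s ⟹[ ρ ++ σ ] t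

  WeakTrace : List (Fin k) → Set
  WeakTrace ρ = ∃ λ t → ι ⟹[ ρ ] t

  Stable : State → Set
  Stable s = ¬ Enabled s τ

  -- X ∈ refusals(s) for stable s, i.e. X ⊆ Act ∖ enabled(s)
  Refusal : State → Subset k → Set
  Refusal s X = ∀ a → a ∈ X → ¬ Enabled s (act a)

  RefusalSet : Subset n → Subset k → Set
  RefusalSet U X = ∃ λ s → s ∈ U × Stable s × Refusal s X

  Diverges : State → Set
  Diverges s = Σ (ℕ → State) λ f → f 0 ≡ s × (∀ i → f i —[ τ ]→ f (suc i))

  DivergesSet : Subset n → Set
  DivergesSet U = ∃ λ s → s ∈ U × Diverges s

  Divergence : List (Fin k) → Set
  Divergence tr = Σ (List (Fin k)) λ ρ → Σ (List (Fin k)) λ σ →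
    tr ≡ ρ ++ σ × (∃ λ t → ι ⟹[ ρ ] t × Diverges t)

  Failure : List (Fin k) → Subset k → Set
  Failure ρ X = ∃ λ t → ι ⟹[ ρ ] t × Stable t × Refusal t X

  Failure⊥ : List (Fin k) → Subset k → Set
  Failure⊥ ρ X = Failure ρ X Data.Sum.⊎ Divergence ρ
    where import Data.Sum

module _ {k : ℕ} (L₁ L₂ : LTS k) where

  _⊑tr_ : Set
  _⊑tr_ = ∀ ρ → WeakTrace L₂ ρ → WeakTrace L₁ ρ

  _⊑sfr_ : Set
  _⊑sfr_ = (∀ ρ X → Failure L₂ ρ X → Failure L₁ ρ X) ×
           (∀ ρ → WeakTrace L₂ ρ → WeakTrace L₁ ρ)

  _⊑fdr_ : Set
  _⊑fdr_ = (∀ ρ X → Failure⊥ L₂ ρ X → Failure⊥ L₁ ρ X) ×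
           (∀ ρ → Divergence L₂ ρ → Divergence L₁ ρ)

-- The algorithms Refines_tr / Refines_sfr / Refines_fdr as a big-step
-- operational semantics.  The (unspecified) order in which the outgoing
-- transitions of impl are visited is given by an enumeration `enum`,
-- which lists every transition of impl exactly once.

data Variant : Set where
  tr sfr fdr : Variant

module Algorithm {k : ℕ} (L₁ L₂ : LTS k) where
  open LTS L₁ renaming (n to n₁; ι to ι₁)
  open LTS L₂ renaming (n to n₂; ι to ι₂)

  Pair : Set
  Pair = Subset n₁ × Fin n₂

  _≤ₚ_ : Pair → Pair → Set
  (U , s) ≤ₚ (V , t) = s ≡ t × U ⊆ V

  _≤ₚ?_ : ∀ x y → Dec (x ≤ₚ y)
  (U , s) ≤ₚ? (V , t) = (s ≟ t) ×-dec (U ⊆? V)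

  _⋐_ : Pair → List Pair → Set
  x ⋐ A = Any (λ y → y ≤ₚ x) A

  _⋓_ : List Pair → Pair → List Pair
  A ⋓ x = x ∷ filter (λ z → ¬? (x ≤ₚ? z)) A

  Enumeration : Set
  Enumeration = Fin n₂ → List (Actτ k × Fin n₂)

  ValidEnumeration : Enumeration → Set
  ValidEnumeration enum = ∀ i → Unique (enum i) ×
    (∀ a i' → (LM._∈_ (a , i') (enum i)) ⇔ (_—[_]→_ L₂ i a i'))

  IsInit : Subset n₁ → Set
  IsInit U = ∀ s → s ∈ U ⇔ _⟹[_]_ L₁ ι₁ [] s

  Succ : Subset n₁ → Actτ k → Subset n₁ → Set
  Succ spec τ       spec' = spec' ≡ spec
  Succ spec (act b) spec' =
    ∀ s' → s' ∈ spec' ⇔ (∃ λ s → s ∈ spec × _⟹[_]_ L₁ s (b ∷ []) s')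

  RefIncl : Subset n₁ → Fin n₂ → Set
  RefIncl spec impl = ∀ X → Refusal L₂ impl X → RefusalSet L₁ spec X

  data CheckResult : Set where
    fail skip go : CheckResult

  data Check : Variant → Subset n₁ → Fin n₂ → CheckResult → Set where
    tr-go    : ∀ {spec impl} → Check tr spec impl go
    sfr-fail : ∀ {spec impl} → Stable L₂ impl → ¬ RefIncl spec impl →
               Check sfr spec impl fail
    sfr-go   : ∀ {spec impl} → ¬ (Stable L₂ impl × ¬ RefIncl spec impl) →
               Check sfr spec impl go
    fdr-skip : ∀ {spec impl} → DivergesSet L₁ spec → Check fdr spec impl skip
    fdr-fail-div : ∀ {spec impl} → ¬ DivergesSet L₁ spec → Diverges L₂ impl →
               Check fdr spec impl fail
    fdr-fail-ref : ∀ {spec impl} → ¬ DivergesSet L₁ spec → ¬ Diverges L₂ impl →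
               Stable L₂ impl → ¬ RefIncl spec impl → Check fdr spec impl fail
    fdr-go   : ∀ {spec impl} → ¬ DivergesSet L₁ spec → ¬ Diverges L₂ impl →
               ¬ (Stable L₂ impl × ¬ RefIncl spec impl) → Check fdr spec impl go

  data ForResult : Set where
    returned-false : ForResult
    continue       : List Pair → List Pair → ForResult

  -- the for-loop over the transitions of impl, for a fixed spec;
  -- indices: remaining transitions, working, antichain, result
  data ForLoop (spec : Subset n₁) :
       List (Actτ k × Fin n₂) → List Pair → List Pair → ForResult → Set where
    for-end   : ∀ {W A} → ForLoop spec [] W A (continue W A)
    for-empty : ∀ {a i' ts W A spec'} → Succ spec a spec' → spec' ≡ ∅ →
                ForLoop spec ((a , i') ∷ ts) W A returned-false
    for-old   : ∀ {a i' ts W A spec' r} → Succ spec a spec' → ¬ spec' ≡ ∅ →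
                (spec' , i') ⋐ A → ForLoop spec ts W A r →
                ForLoop spec ((a , i') ∷ ts) W A r
    for-new   : ∀ {a i' ts W A spec' r} → Succ spec a spec' → ¬ spec' ≡ ∅ →
                ¬ ((spec' , i') ⋐ A) →
                ForLoop spec ts ((spec' , i') ∷ W) (A ⋓ (spec' , i')) r →
                ForLoop spec ((a , i') ∷ ts) W A r

  -- the while-loop; indices: working stack, antichain, returned value
  data Run (v : Variant) (enum : Enumeration) :
       List Pair → List Pair → Bool → Set where
    run-done  : ∀ {A} → Run v enum [] A true
    run-fail  : ∀ {spec impl W A} → Check v spec impl fail →
                Run v enum ((spec , impl) ∷ W) A false
    run-skip  : ∀ {spec impl W A b} → Check v spec impl skip →
                Run v enum W A b → Run v enum ((spec , impl) ∷ W) A b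
    run-loop-fail : ∀ {spec impl W A} → Check v spec impl go →
                ForLoop spec (enum impl) W A returned-false →
                Run v enum ((spec , impl) ∷ W) A false
    run-loop  : ∀ {spec impl W A W' A' b} → Check v spec impl go →
                ForLoop spec (enum impl) W A (continue W' A') →
                Run v enum W' A' b → Run v enum ((spec , impl) ∷ W) A b

  Returns : Variant → Enumeration → Bool → Set
  Returns v enum b = ∃ λ I → IsInit I ×
    Run v enum ((I , ι₂) ∷ []) ((I , ι₂) ∷ []) b

open Algorithm public using (Returns; ValidEnumeration)

module Submission where

-- Soundness: a successful run leaves a certificate, a list of pairs with nonempty
-- spec sets, each skipped (spec diverges; fdr only) or passing the checks with
-- every impl transition leading to a pair dominated by the list.  Following an
-- impl path through it yields spec states reached along the same trace (or a spec
-- divergence), which is what the refinements ask for.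
-- Completeness: under refinement every pushed pair (U , i) is explained by a trace
-- ρ with U exactly the spec states reached along ρ and i reached along ρ; then no
-- check fails and no spec' is empty, and a run exists since twice the number of
-- pairs not covered by the antichain, plus the stack height, decreases.

open import Defs
open import Data.Bool using (true; false)
open import Data.Bool.Properties using (T?)
open import Data.Empty using (⊥-elim)
open import Data.Fin using (Fin)
open import Data.Fin.Properties using (any?; all?)
open import Data.Fin.Subset
  using (Subset; _∈_; _∉_; _⊆_; _⊂_; _⊃_; _∪_; _∩_; ⁅_⁆; inside; outside; Nonempty)
  renaming (⊤ to full; ⊥ to ∅)
open import Data.Fin.Subset.Properties
  using (_∈?_; _⊆?_; p⊆p∪q; q⊆p∪q; x∈p∪q⁻; x∈p∩q⁺; x∈p∩q⁻; p∩q⊆p; ∈⊤; x∈⁅y⁆⇔x≡y; ∉⊥; nonempty?; Empty-unique)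
open import Data.Fin.Subset.Induction using (⊂-wellFounded; ⊃-wellFounded)
open import Data.List using (List; []; _∷_; _++_; map; length; allFin; cartesianProduct)
open import Data.List.Properties using (++-identityʳ; ++-assoc; ∷-injective)
open import Data.List.Membership.Propositional using (find; lose) renaming (_∈_ to _∈ₗ_)
open import Data.List.Membership.Propositional.Properties
  using (∈-++⁺ˡ; ∈-++⁺ʳ; ∈-++⁻; ∈-map⁺; ∈-filter⁻; ∈-filter⁺; ∈-allFin; ∈-cartesianProduct⁺)
open import Data.List.Relation.Binary.Subset.Propositional using () renaming (_⊆_ to _⊆ₗ_)
open import Data.List.Relation.Binary.Subset.Propositional.Properties
  using (Any-resp-⊆; ⊆-reflexive; ⊆-reflexive-↭; ++⁺ʳ)
open import Data.List.Relation.Binary.Permutation.Propositional using (↭-sym)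
open import Data.List.Relation.Binary.Permutation.Propositional.Properties using (shift)
open import Data.List.Relation.Unary.Any using (here; there)
import Data.List.Relation.Unary.Any as Any
open import Data.Nat using (ℕ; zero; suc; _+_; _≤_; _<_; z≤n; s≤s)
open import Data.Nat.Properties
  using (≤-refl; ≤-trans; n≤1+n; m≤n⇒m≤1+n; +-suc; +-mono-≤; +-monoˡ-≤; <⇒≤; ≤-pred)
open import Data.Product using (Σ; ∃; _×_; _,_; proj₁; proj₂)
open import Data.Sum using (_⊎_; inj₁; inj₂; [_,_])
open import Data.Unit using (⊤; tt)
open import Data.Vec using (tabulate) renaming ([] to []ᵛ; _∷_ to _∷ᵛ_)
open import Data.Vec.Properties using (lookup∘tabulate; []=⇒lookup; lookup⇒[]=)
open import Function.Bundles using (_⇔_; mk⇔; Equivalence)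
open import Induction.WellFounded using (WellFounded; Acc; acc)
open import Relation.Binary.Construct.Closure.ReflexiveTransitive using (Star; ε; _◅_; _◅◅_)
open import Relation.Binary.PropositionalEquality using (_≡_; refl; sym; trans; subst; cong)
open import Relation.Nullary using (¬_; Dec; yes; no; does)
open import Relation.Nullary.Decidable using (_×-dec_; _⊎-dec_; ¬?; dec-true)

open Equivalence using (to; from)

-- The strict comparison below drives the termination argument of the
-- algorithm: a strictly larger predicate has strictly more witnesses.

count : {A : Set} {P : A → Set} → (∀ x → Dec (P x)) → List A → ℕ
count P? [] = 0
count P? (x ∷ xs) with P? x
... | yes _ = suc (count P? xs)
... | no _ = count P? xs

module _ {A : Set} {P Q : A → Set} (P? : ∀ x → Dec (P x)) (Q? : ∀ x → Dec (Q x))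
         (P⇒Q : ∀ {x} → P x → Q x) where

  count-mono : ∀ xs → count P? xs ≤ count Q? xs
  count-mono [] = z≤n
  count-mono (x ∷ xs) with P? x | Q? x
  ... | yes _ | yes _ = s≤s (count-mono xs)
  ... | yes p | no ¬q = ⊥-elim (¬q (P⇒Q p))
  ... | no _  | yes _ = m≤n⇒m≤1+n (count-mono xs)
  ... | no _  | no _  = count-mono xs

  count-strict : ∀ {y} xs → y ∈ₗ xs → ¬ P y → Q y → count P? xs < count Q? xs
  count-strict (x ∷ xs) (here refl) ¬py qy with P? x | Q? x
  ... | yes py | _      = ⊥-elim (¬py py)
  ... | no _   | yes _  = s≤s (count-mono xs)
  ... | no _   | no ¬qy = ⊥-elim (¬qy qy)
  count-strict (x ∷ xs) (there y∈xs) ¬py qy with P? x | Q? x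
  ... | yes _ | yes _  = s≤s (count-strict xs y∈xs ¬py qy)
  ... | yes p | no ¬q  = ⊥-elim (¬q (P⇒Q p))
  ... | no _  | yes _  = ≤-trans (count-strict xs y∈xs ¬py qy) (n≤1+n _)
  ... | no _  | no _   = count-strict xs y∈xs ¬py qy

-- The list of all subsets of Fin n, so that finitely many pairs can be counted.

allSubsets : ∀ n → List (Subset n)
allSubsets zero = []ᵛ ∷ []
allSubsets (suc n) = map (inside ∷ᵛ_) (allSubsets n) ++ map (outside ∷ᵛ_) (allSubsets n)

∈-allSubsets : ∀ {n} (U : Subset n) → U ∈ₗ allSubsets n
∈-allSubsets []ᵛ = here refl
∈-allSubsets (true ∷ᵛ U) = ∈-++⁺ˡ (∈-map⁺ (inside ∷ᵛ_) (∈-allSubsets U))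
∈-allSubsets {suc n} (false ∷ᵛ U) =
  ∈-++⁺ʳ (map (inside ∷ᵛ_) (allSubsets n)) (∈-map⁺ (outside ∷ᵛ_) (∈-allSubsets U))

⟦_⟧ : ∀ {n} {P : Fin n → Set} → (∀ x → Dec (P x)) → Subset n
⟦ P? ⟧ = tabulate (λ x → does (P? x))

∈⟦⟧ : ∀ {n} {P : Fin n → Set} (P? : ∀ x → Dec (P x)) {x} → x ∈ ⟦ P? ⟧ ⇔ P x
∈⟦⟧ {P = P} P? {x} = mk⇔
  (λ x∈ → accepted (P? x) (trans (sym (lookup∘tabulate _ x)) ([]=⇒lookup x∈)))
  (λ px → lookup⇒[]= x _ (trans (lookup∘tabulate _ x) (dec-true (P? x) px)))
  where
  accepted : (d : Dec (P x)) → does d ≡ true → P x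
  accepted (yes px) _ = px

⊈-witness : ∀ {n} {p q : Subset n} → ¬ p ⊆ q → ∃ λ x → x ∈ p × x ∉ q
⊈-witness {p = p} {q} p⊈q with any? (λ x → (x ∈? p) ×-dec ¬? (x ∈? q))
... | yes (x , x∈p , x∉q) = x , x∈p , x∉q
... | no none = ⊥-elim (p⊈q included)
  where
  included : p ⊆ q
  included {x} x∈p with x ∈? q
  ... | yes x∈q = x∈q
  ... | no x∉q = ⊥-elim (none (x , x∈p , x∉q))

wf-search : ∀ {A : Set} {_≺_ : A → A → Set} → WellFounded _≺_ →
  (Inv Goal : A → Set) → (∀ x → Inv x → Goal x ⊎ ∃ λ y → y ≺ x × Inv y) →
  ∀ x → Inv x → ∃ λ y → Inv y × Goal y
wf-search {A} {_≺_} wf Inv Goal step x inv = go x (wf x) inv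
  where
  go : ∀ x → Acc _≺_ x → Inv x → ∃ λ y → Inv y × Goal y
  go x (acc smaller) inv with step x inv
  ... | inj₁ goal = x , inv , goal
  ... | inj₂ (y , y≺x , inv-y) = go y (smaller y≺x) inv-y

-- Reachability and divergence for a decidable relation on a finite set,
-- computed as least and greatest fixed points by iteration on subsets.

module FiniteGraph {n : ℕ} (E : Fin n → Fin n → Set) (E? : ∀ s t → Dec (E s t)) where

  Reachable : Subset n → Fin n → Set
  Reachable U t = ∃ λ s → s ∈ U × Star E s t

  Div : Fin n → Set
  Div s = Σ (ℕ → Fin n) λ f → f 0 ≡ s × (∀ i → E (f i) (f (suc i)))

  post pre : Subset n → Subset n
  post U = ⟦ (λ t → any? (λ s → (s ∈? U) ×-dec E? s t)) ⟧
  pre U = ⟦ (λ s → any? (λ t → (t ∈? U) ×-dec E? s t)) ⟧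

  ∈post : ∀ {U t} → t ∈ post U ⇔ ∃ λ s → s ∈ U × E s t
  ∈post {U} = ∈⟦⟧ (λ t → any? (λ s → (s ∈? U) ×-dec E? s t))

  ∈pre : ∀ {U s} → s ∈ pre U ⇔ ∃ λ t → t ∈ U × E s t
  ∈pre {U} = ∈⟦⟧ (λ s → any? (λ t → (t ∈? U) ×-dec E? s t))

  -- the least set containing U and closed under E, reached by adding
  -- successors until none is missing (the set grows at each step)
  closure : (U : Subset n) → Σ (Subset n) λ C → ∀ t → t ∈ C ⇔ Reachable U t
  closure U with wf-search ⊃-wellFounded Sound Closed grow U ((λ t∈U → t∈U) , λ {t} t∈U → t , t∈U , ε)
    where
    Sound Closed : Subset n → Set
    Sound V = U ⊆ V × (∀ {t} → t ∈ V → Reachable U t)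
    Closed V = post V ⊆ V
    grow : ∀ V → Sound V → Closed V ⊎ ∃ λ W → W ⊃ V × Sound W
    grow V (U⊆V , V-reach) with post V ⊆? V
    ... | yes closed = inj₁ closed
    ... | no not-closed with ⊈-witness not-closed
    ... | x , x∈post , x∉V = inj₂ (V ∪ post V , (p⊆p∪q (post V) , x , q⊆p∪q V (post V) x∈post , x∉V) ,
                                  (λ t∈U → p⊆p∪q (post V) (U⊆V t∈U)) , reach)
      where
      reach : ∀ {t} → t ∈ V ∪ post V → Reachable U t
      reach {t} t∈ with x∈p∪q⁻ V (post V) t∈
      ... | inj₁ t∈V = V-reach t∈V
      ... | inj₂ t∈post with to ∈post t∈post
      ... | s , s∈V , s→t with V-reach s∈V
      ... | r , r∈U , r→*s = r , r∈U , r→*s ◅◅ (s→t ◅ ε)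
  ... | C , (U⊆C , C-reach) , closed = C , λ t → mk⇔ C-reach (λ { (s , s∈U , s→*t) → along (U⊆C s∈U) s→*t })
    where
    along : ∀ {s t} → s ∈ C → Star E s t → t ∈ C
    along s∈C ε = s∈C
    along s∈C (s→u ◅ u→*t) = along (closed (from ∈post (_ , s∈C , s→u))) u→*t

  postfixed-div : (R : Fin n → Set) → (∀ s → R s → ∃ λ t → R t × E s t) → ∀ s → R s → Div s
  postfixed-div R next s r = (λ i → proj₁ (path i)) , refl , λ i → proj₂ (proj₂ (next _ (proj₂ (path i))))
    where
    path : ℕ → Σ (Fin n) R
    path zero = s , r
    path (suc i) = let (t , rt , _) = next _ (proj₂ (path i)) in t , rt

  -- the greatest set all of whose states have a successor in it, reached by
  -- removing states without successors (the set shrinks at each step)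
  divergent : Σ (Subset n) λ D → ∀ s → s ∈ D ⇔ Div s
  divergent with wf-search ⊂-wellFounded Complete Postfixed shrink full (λ _ → ∈⊤)
    where
    Complete Postfixed : Subset n → Set
    Complete V = ∀ {s} → Div s → s ∈ V
    Postfixed V = V ⊆ pre V
    shrink : ∀ V → Complete V → Postfixed V ⊎ ∃ λ W → W ⊂ V × Complete W
    shrink V all-div with V ⊆? pre V
    ... | yes postfixed = inj₁ postfixed
    ... | no ¬postfixed with ⊈-witness ¬postfixed
    ... | x , x∈V , x∉pre = inj₂ (V ∩ pre V , (p∩q⊆p V (pre V) , x , x∈V , λ x∈ → x∉pre (proj₂ (x∈p∩q⁻ V (pre V) x∈))) ,
                                   λ d → x∈p∩q⁺ (all-div d , from ∈pre (successor d)))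
      where
      successor : ∀ {s} → Div s → ∃ λ t → t ∈ V × E s t
      successor (f , refl , steps) = f 1 , all-div ((λ i → f (suc i)) , refl , λ i → steps (suc i)) , steps 0
  ... | D , complete , postfixed = D , λ s → mk⇔ (postfixed-div (_∈ D) next s) complete
    where
    next : ∀ s → s ∈ D → ∃ λ t → t ∈ D × E s t
    next s s∈D = to ∈pre (postfixed s∈D)

module LTSFacts {k : ℕ} (L : LTS k) where
  open LTS L

  -- Weak paths, one transition at a time: an inductive normal form of the
  -- weak transition relation that can be split and walked along.
  data Path : Fin n → List (Fin k) → Fin n → Set where
    nil      : ∀ {s} → Path s [] s
    τ-step   : ∀ {s u t ρ} → _—[_]→_ L s τ u → Path u ρ t → Path s ρ t
    act-step : ∀ {s u t a ρ} → _—[_]→_ L s (act a) u → Path u ρ t → Path s (a ∷ ρ) t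

  _++ᵖ_ : ∀ {s u t ρ σ} → Path s ρ u → Path u σ t → Path s (ρ ++ σ) t
  nil ++ᵖ q = q
  τ-step e p ++ᵖ q = τ-step e (p ++ᵖ q)
  act-step e p ++ᵖ q = act-step e (p ++ᵖ q)

  path⇒weak : ∀ {s ρ t} → Path s ρ t → _⟹[_]_ L s ρ t
  path⇒weak nil = ε-refl
  path⇒weak (τ-step e p) = cat (ε-τ e) (path⇒weak p)
  path⇒weak (act-step e p) = cat (vis e) (path⇒weak p)

  weak⇒path : ∀ {s ρ t} → _⟹[_]_ L s ρ t → Path s ρ t
  weak⇒path ε-refl = nil
  weak⇒path (ε-τ e) = τ-step e nil
  weak⇒path (vis e) = act-step e nil
  weak⇒path (cat p q) = weak⇒path p ++ᵖ weak⇒path q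

  split : ∀ ρ σ {s t} → Path s (ρ ++ σ) t → ∃ λ u → Path s ρ u × Path u σ t
  split [] σ p = _ , nil , p
  split (a ∷ ρ) σ (τ-step e p) with split (a ∷ ρ) σ p
  ... | u , q , r = u , τ-step e q , r
  split (a ∷ ρ) σ (act-step e p) with split ρ σ p
  ... | u , q , r = u , act-step e q , r

  τ→ : Fin n → Fin n → Set
  τ→ s t = _—[_]→_ L s τ t

  step? : ∀ s a t → Dec (_—[_]→_ L s a t)
  step? s a t = T? (δ s a t)

  enabled? : ∀ s a → Dec (Enabled L s a)
  enabled? s a = any? (step? s a)

  stable? : ∀ s → Dec (Stable L s)
  stable? s = ¬? (enabled? s τ)

  refusal? : ∀ s X → Dec (Refusal L s X)
  refusal? s X with all? (λ a → ¬? (a ∈? X) ⊎-dec ¬? (enabled? s (act a)))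
  ... | yes each = yes λ a a∈X en → [ (λ a∉X → a∉X a∈X) , (λ ¬en → ¬en en) ] (each a)
  ... | no ¬each = no λ r → ¬each λ a → refused r a
    where
    refused : Refusal L s X → ∀ a → a ∉ X ⊎ ¬ Enabled L s (act a)
    refused r a with a ∈? X
    ... | yes a∈X = inj₂ (r a a∈X)
    ... | no a∉X = inj₁ a∉X

  refusalSet? : ∀ U X → Dec (RefusalSet L U X)
  refusalSet? U X = any? (λ s → (s ∈? U) ×-dec (stable? s ×-dec refusal? s X))

  τ-path⇒star : ∀ {s t} → Path s [] t → Star τ→ s t
  τ-path⇒star nil = ε
  τ-path⇒star (τ-step e p) = e ◅ τ-path⇒star p

  star⇒τ-path : ∀ {s t} → Star τ→ s t → Path s [] t
  star⇒τ-path ε = nil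
  star⇒τ-path (e ◅ p) = τ-step e (star⇒τ-path p)

  single-path⇒ : ∀ {s a t} → Path s (a ∷ []) t →
    ∃ λ u → ∃ λ v → Path s [] u × _—[_]→_ L u (act a) v × Path v [] t
  single-path⇒ (τ-step e p) with single-path⇒ p
  ... | u , v , q , e' , r = u , v , τ-step e q , e' , r
  single-path⇒ (act-step e p) = _ , _ , nil , e , p

  open FiniteGraph τ→ (λ s t → step? s τ t) using (postfixed-div)
    renaming (closure to τ-closure′; divergent to divergent′)

  -- The subsets below are opaque: only their membership lemmas are used, and
  -- unfolding the fixed-point computations during type checking is costly.
  opaque
    τ-closure : Subset n → Subset n
    τ-closure U = proj₁ (τ-closure′ U)

    ∈τ-closure : ∀ {U t} → t ∈ τ-closure U ⇔ ∃ λ s → s ∈ U × Path s [] t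
    ∈τ-closure {U} {t} = mk⇔
      (λ t∈ → let (s , s∈U , s→*t) = to (proj₂ (τ-closure′ U) t) t∈ in s , s∈U , star⇒τ-path s→*t)
      (λ { (s , s∈U , p) → from (proj₂ (τ-closure′ U) t) (s , s∈U , τ-path⇒star p) })

  opaque
    act-image : Fin k → Subset n → Subset n
    act-image a U = ⟦ (λ v → any? (λ u → (u ∈? U) ×-dec step? u (act a) v)) ⟧

    ∈act-image : ∀ {a U v} → v ∈ act-image a U ⇔ ∃ λ u → u ∈ U × _—[_]→_ L u (act a) v
    ∈act-image {a} {U} = ∈⟦⟧ (λ v → any? (λ u → (u ∈? U) ×-dec step? u (act a) v))

  after : Fin k → Subset n → Subset n
  after a U = τ-closure (act-image a (τ-closure U))

  ∈after : ∀ {a U t} → t ∈ after a U ⇔ ∃ λ s → s ∈ U × Path s (a ∷ []) t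
  ∈after {a} {U} {t} = mk⇔ to′ from′
    where
    to′ : t ∈ after a U → ∃ λ s → s ∈ U × Path s (a ∷ []) t
    to′ t∈ with to ∈τ-closure t∈
    ... | v , v∈ , v→t with to ∈act-image v∈
    ... | u , u∈ , u→v with to ∈τ-closure u∈
    ... | s , s∈U , s→u = s , s∈U , s→u ++ᵖ act-step u→v v→t
    from′ : (∃ λ s → s ∈ U × Path s (a ∷ []) t) → t ∈ after a U
    from′ (s , s∈U , p) with single-path⇒ p
    ... | u , v , s→u , u→v , v→t =
      from ∈τ-closure (v , from ∈act-image (u , from ∈τ-closure (s , s∈U , s→u) , u→v) , v→t)

  initial : Subset n
  initial = τ-closure ⁅ ι ⁆

  ∈initial : ∀ {t} → t ∈ initial ⇔ Path ι [] t
  ∈initial = mk⇔ (λ t∈ → let (s , s∈ , p) = to ∈τ-closure t∈ in at-ι (to x∈⁅y⁆⇔x≡y s∈) p)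
                 (λ p → from ∈τ-closure (ι , from x∈⁅y⁆⇔x≡y refl , p))
    where
    at-ι : ∀ {s t} → s ≡ ι → Path s [] t → Path ι [] t
    at-ι refl p = p

  diverges? : ∀ s → Dec (Diverges L s)
  diverges? s with s ∈? proj₁ divergent′
  ... | yes s∈ = yes (to (proj₂ divergent′ s) s∈)
  ... | no s∉ = no λ d → s∉ (from (proj₂ divergent′ s) d)

  divergesSet? : ∀ U → Dec (DivergesSet L U)
  divergesSet? U = any? (λ s → (s ∈? U) ×-dec diverges? s)

  stable-or-diverges : ∀ s → (∃ λ t → Path s [] t × Stable L t) ⊎ Diverges L s
  stable-or-diverges s with any? (λ t → (t ∈? τ-closure ⁅ s ⁆) ×-dec stable? t)
  ... | yes (t , t∈ , stable) with to ∈τ-closure t∈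
  ... | s′ , s′∈ , p with to x∈⁅y⁆⇔x≡y s′∈
  ... | refl = inj₁ (t , p , stable)
  stable-or-diverges s | no none = inj₂ (postfixed-div (λ t → Path s [] t) next s nil)
    where
    next : ∀ t → Path s [] t → ∃ λ u → Path s [] u × τ→ t u
    next t p with enabled? t τ
    ... | yes (u , e) = u , p ++ᵖ τ-step e nil , e
    ... | no stable = ⊥-elim (none (t , from ∈τ-closure (s , from x∈⁅y⁆⇔x≡y refl , p) , stable))

-- the algorithm tests spec' = ∅; for subsets this is the negation of Nonempty
nonempty⇒≢∅ : ∀ {n} {U : Subset n} → Nonempty U → ¬ U ≡ ∅
nonempty⇒≢∅ (x , x∈U) refl = ∉⊥ x∈U

≢∅⇒nonempty : ∀ {n} {U : Subset n} → ¬ U ≡ ∅ → Nonempty U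
≢∅⇒nonempty {U = U} U≢∅ with nonempty? U
... | yes ne = ne
... | no empty = ⊥-elim (U≢∅ (Empty-unique empty))

snoc-split : ∀ {A : Set} (ρ ρ' : List A) a b σ → ρ ++ a ∷ [] ≡ ρ' ++ b ∷ σ →
  ρ' ≡ ρ ⊎ ∃ λ σ' → ρ ≡ ρ' ++ b ∷ σ'
snoc-split [] [] a b σ eq = inj₁ refl
snoc-split [] (c ∷ []) a b σ ()
snoc-split [] (c ∷ d ∷ ρ') a b σ ()
snoc-split (c ∷ ρ) [] a b σ eq with ∷-injective eq
... | refl , _ = inj₂ (ρ , refl)
snoc-split (c ∷ ρ) (d ∷ ρ') a b σ eq with ∷-injective eq
... | refl , eq' with snoc-split ρ ρ' a b σ eq'
...   | inj₁ refl = inj₁ refl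
...   | inj₂ (σ' , eq'') = inj₂ (σ' , cong (d ∷_) eq'')

module Correctness {k : ℕ} (L₁ L₂ : LTS k) (enum : Algorithm.Enumeration L₁ L₂)
                   (valid : ValidEnumeration L₁ L₂ enum) where
  open Algorithm L₁ L₂ hiding (Returns; ValidEnumeration)
  open LTS L₁ using () renaming (n to n₁; ι to ι₁)
  open LTS L₂ using () renaming (n to n₂; ι to ι₂)
  module Spec = LTSFacts L₁
  module Impl = LTSFacts L₂

  Refinement : Variant → Set
  Refinement tr = L₁ ⊑tr L₂
  Refinement sfr = L₁ ⊑sfr L₂
  Refinement fdr = L₁ ⊑fdr L₂

  Reached : List (Fin k) → Subset n₁ → Set
  Reached ρ U = ∀ {s} → s ∈ U → Spec.Path ι₁ ρ s

  ≤ₚ-refl : ∀ x → x ≤ₚ x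
  ≤ₚ-refl (U , i) = refl , λ s∈U → s∈U

  ≤ₚ-trans : ∀ {x y z} → x ≤ₚ y → y ≤ₚ z → x ≤ₚ z
  ≤ₚ-trans (refl , U⊆V) (refl , V⊆W) = refl , λ s∈U → V⊆W (U⊆V s∈U)

  ⋐-self : ∀ {x A} → x ∈ₗ A → x ⋐ A
  ⋐-self {x} x∈A = lose x∈A (≤ₚ-refl x)

  ⋐-mono : ∀ {x A B} → A ⊆ₗ B → x ⋐ A → x ⋐ B
  ⋐-mono = Any-resp-⊆

  ⋐-trans : ∀ {x A B} → x ⋐ A → (∀ {y} → y ∈ₗ A → y ⋐ B) → x ⋐ B
  ⋐-trans x⋐A A⋐B with find x⋐A
  ... | y , y∈A , y≤x with find (A⋐B y∈A)
  ... | z , z∈B , z≤y = lose z∈B (≤ₚ-trans z≤y y≤x)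

  ⋐-⋓ : ∀ {x y A} → x ⋐ A → x ⋐ (A ⋓ y)
  ⋐-⋓ {x} {y} {A} x⋐A with find x⋐A
  ... | z , z∈A , z≤x with y ≤ₚ? z
  ... | yes y≤z = here (≤ₚ-trans y≤z z≤x)
  ... | no y≰z = there (lose (∈-filter⁺ (λ w → ¬? (y ≤ₚ? w)) z∈A y≰z) z≤x)

  ⋓-⊆ : ∀ {y A} → (A ⋓ y) ⊆ₗ (y ∷ A)
  ⋓-⊆ (here refl) = here refl
  ⋓-⊆ {y} {A} (there z∈) = there (proj₁ (∈-filter⁻ (λ w → ¬? (y ≤ₚ? w)) {xs = A} z∈))

  passes-refusals : ∀ {U i} → ¬ (Stable L₂ i × ¬ RefIncl U i) → Stable L₂ i → RefIncl U i
  passes-refusals {U} h stable X refusal with Spec.refusalSet? U X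
  ... | yes matched = matched
  ... | no ¬matched = ⊥-elim (h (stable , λ incl → ¬matched (incl X refusal)))

  skip-diverges : ∀ {v U i} → Check v U i skip → v ≡ fdr × DivergesSet L₁ U
  skip-diverges (fdr-skip d) = refl , d

  Closed : Variant → List Pair → Pair → Set
  Closed v D (U , i) = Check v U i skip ⊎
    (Check v U i go × ∀ a i' → _—[_]→_ L₂ i a i' → ∃ λ U' → Succ U a U' × (U' , i') ⋐ D)

  Closed-mono : ∀ {v D D'} x → D ⊆ₗ D' → Closed v D x → Closed v D' x
  Closed-mono (U , i) D⊆D' (inj₁ skipped) = inj₁ skipped
  Closed-mono (U , i) D⊆D' (inj₂ (passed , matched)) =
    inj₂ (passed , λ a i' e → let (U' , succ , cov) = matched a i' e in U' , succ , ⋐-mono D⊆D' cov)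

  record Certificate (v : Variant) (D : List Pair) : Set where
    field
      closed   : ∀ {x} → x ∈ₗ D → Closed v D x
      nonempty : ∀ {U i} → (U , i) ∈ₗ D → Nonempty U

  record ForLoopEffect (spec : Subset n₁) (ts : List (Actτ k × Fin n₂)) (W A W' A' : List Pair) : Set where
    field
      keeps     : W ⊆ₗ W'
      antichain : A' ⊆ₗ (A ++ W')
      pushed    : ∀ {U i} → (U , i) ∈ₗ W' → (U , i) ∈ₗ W ⊎ Nonempty U
      matched   : ∀ {a i'} → (a , i') ∈ₗ ts → ∃ λ U' → Succ spec a U' × (U' , i') ⋐ (A ++ W')

  for-loop-effect : ∀ {spec ts W A W' A'} → ForLoop spec ts W A (continue W' A') →
    ForLoopEffect spec ts W A W' A'
  for-loop-effect for-end = record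
    { keeps = λ m → m ; antichain = ∈-++⁺ˡ ; pushed = inj₁ ; matched = λ () }
  for-loop-effect (for-old {spec' = U'} succ _ cov rest) = record
    { keeps = keeps ; antichain = antichain ; pushed = pushed
    ; matched = λ { (here refl) → U' , succ , ⋐-mono ∈-++⁺ˡ cov ; (there m) → matched m } }
    where open ForLoopEffect (for-loop-effect rest)
  for-loop-effect {W = W} {A} {W'} (for-new {i' = i'} {spec' = U'} succ U'≢∅ _ rest) = record
    { keeps = λ m → keeps (there m)
    ; antichain = λ m → shrink (antichain m)
    ; pushed = pushed′
    ; matched = λ { (here refl) → U' , succ , ⋐-self (∈-++⁺ʳ A (keeps (here refl)))
                  ; (there m) → let (U'' , succ' , cov) = matched m in U'' , succ' , ⋐-mono shrink cov } }
    where
    open ForLoopEffect (for-loop-effect rest)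
    pushed′ : ∀ {U i} → (U , i) ∈ₗ W' → (U , i) ∈ₗ W ⊎ Nonempty U
    pushed′ m with pushed m
    ... | inj₁ (here refl) = inj₂ (≢∅⇒nonempty U'≢∅)
    ... | inj₁ (there m') = inj₁ m'
    ... | inj₂ ne = inj₂ ne
    shrink : ((A ⋓ (U' , i')) ++ W') ⊆ₗ (A ++ W')
    shrink m with ∈-++⁻ (A ⋓ (U' , i')) m
    ... | inj₂ m' = ∈-++⁺ʳ A m'
    ... | inj₁ m' with ⋓-⊆ {A = A} m'
    ...   | here refl = ∈-++⁺ʳ A (keeps (here refl))
    ...   | there m'' = ∈-++⁺ˡ m''

  -- Invariant of a successful run with processed pairs D and stack W:
  -- the antichain is covered, processed pairs are closed, specs are nonempty.
  record RunInvariant (v : Variant) (D W A : List Pair) : Set where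
    field
      covered  : ∀ {y} → y ∈ₗ A → y ⋐ (D ++ W)
      closed   : ∀ {x} → x ∈ₗ D → Closed v (D ++ W) x
      nonempty : ∀ {U i} → (U , i) ∈ₗ (D ++ W) → Nonempty U

  pop-⊆ : ∀ {D W : List Pair} {x} → (D ++ x ∷ W) ⊆ₗ ((x ∷ D) ++ W)
  pop-⊆ {D} {W} {x} = ⊆-reflexive-↭ (shift x D W)

  pop-⊇ : ∀ {D W : List Pair} {x} → ((x ∷ D) ++ W) ⊆ₗ (D ++ x ∷ W)
  pop-⊇ {D} {W} {x} = ⊆-reflexive-↭ (↭-sym (shift x D W))

  skip-preserves : ∀ {v D W A U i} → RunInvariant v D ((U , i) ∷ W) A → Check v U i skip →
    RunInvariant v ((U , i) ∷ D) W A
  skip-preserves inv skipped = record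
    { covered = λ m → ⋐-mono pop-⊆ (covered m)
    ; closed = λ { (here refl) → inj₁ skipped ; (there m) → Closed-mono _ pop-⊆ (closed m) }
    ; nonempty = λ m → nonempty (pop-⊇ m) }
    where open RunInvariant inv

  -- processing a pair that passes the checks and whose for-loop completes
  -- preserves the invariant: all its successors are now covered
  loop-preserves : ∀ {v D W A W' A' U i} → RunInvariant v D ((U , i) ∷ W) A → Check v U i go →
    ForLoop U (enum i) W A (continue W' A') → RunInvariant v ((U , i) ∷ D) W' A'
  loop-preserves {v} {D} {W} {A} {W'} {U = U} {i} inv passed loop = record
    { covered = λ m → known (antichain m)
    ; closed = λ { (here refl) → inj₂ (passed , λ a i' e →
                     let (U' , succ , cov) = matched (from (proj₂ (valid i) a i') e) in U' , succ , ⋐-trans cov known)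
                 ; (there m) → Closed-mono _ widen (closed m) }
    ; nonempty = nonempty′ }
    where
    open RunInvariant inv
    open ForLoopEffect (for-loop-effect loop)
    widen : (D ++ (U , i) ∷ W) ⊆ₗ (((U , i) ∷ D) ++ W')
    widen m = ++⁺ʳ ((U , i) ∷ D) keeps (pop-⊆ m)
    known : ∀ {y} → y ∈ₗ (A ++ W') → y ⋐ (((U , i) ∷ D) ++ W')
    known m with ∈-++⁻ A m
    ... | inj₁ y∈A = ⋐-mono widen (covered y∈A)
    ... | inj₂ y∈W' = ⋐-self (∈-++⁺ʳ ((U , i) ∷ D) y∈W')
    nonempty′ : ∀ {U' i'} → (U' , i') ∈ₗ (((U , i) ∷ D) ++ W') → Nonempty U'
    nonempty′ m with ∈-++⁻ ((U , i) ∷ D) m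
    ... | inj₁ old = nonempty (pop-⊇ (∈-++⁺ˡ old))
    ... | inj₂ new with pushed new
    ...   | inj₁ old = nonempty (pop-⊇ (∈-++⁺ʳ ((U , i) ∷ D) old))
    ...   | inj₂ ne = ne

  run-certificate : ∀ {v W A} D → Run v enum W A true → RunInvariant v D W A →
    ∃ λ D' → Certificate v D' × (D ++ W) ⊆ₗ D'
  run-certificate D run-done inv = D , record { closed = closed′ ; nonempty = λ m → nonempty (D⊆D++[] m) } , D++[]⊆D
    where
    open RunInvariant inv
    D++[]⊆D : (D ++ []) ⊆ₗ D
    D++[]⊆D = ⊆-reflexive (++-identityʳ D)
    D⊆D++[] : D ⊆ₗ (D ++ [])
    D⊆D++[] = ⊆-reflexive (sym (++-identityʳ D))
    closed′ : ∀ {x} → x ∈ₗ D → Closed _ D x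
    closed′ m = Closed-mono _ D++[]⊆D (closed m)
  run-certificate D (run-skip skipped run) inv with run-certificate _ run (skip-preserves inv skipped)
  ... | D' , cert , known⊆D' = D' , cert , λ m → known⊆D' (pop-⊆ m)
  run-certificate {W = x ∷ W} D (run-loop passed loop run) inv
    with run-certificate _ run (loop-preserves inv passed loop)
  ... | D' , cert , known⊆D' =
    D' , cert , λ m → known⊆D' (++⁺ʳ (x ∷ D) (ForLoopEffect.keeps (for-loop-effect loop)) (pop-⊆ m))

  start-invariant : ∀ {v I} → IsInit I → RunInvariant v [] ((I , ι₂) ∷ []) ((I , ι₂) ∷ [])
  start-invariant init = record
    { covered = λ { (here refl) → ⋐-self (here refl) }
    ; closed = λ ()
    ; nonempty = λ { (here refl) → ι₁ , from (init ι₁) ε-refl } }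

  Matched : Variant → List (Fin k) → Fin n₂ → Set
  Matched v ρ t = (v ≡ fdr × Divergence L₁ ρ) ⊎ ∃ λ U → Nonempty U × Reached ρ U × Check v U t go

  diverged : ∀ {v U σ ρ t} → v ≡ fdr × DivergesSet L₁ U → Reached σ U → Matched v (σ ++ ρ) t
  diverged {σ = σ} {ρ} (v≡fdr , s , s∈U , div) reached =
    inj₁ (v≡fdr , σ , ρ , refl , s , Spec.path⇒weak (reached s∈U) , div)

  -- In a certificate, impl paths can be followed pair by pair: each impl
  -- transition leads to a dominated pair whose spec states are still reached.
  module Simulation {v : Variant} {D : List Pair} (cert : Certificate v D) where
    open Certificate cert

    mutual
      follow : ∀ {U s σ ρ t} → (U , s) ∈ₗ D → Reached σ U → Impl.Path s ρ t → Matched v (σ ++ ρ) t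
      follow m reached p with closed m
      ... | inj₁ skipped = diverged (skip-diverges skipped) reached
      ... | inj₂ (passed , matched) = follow-passed m reached passed matched p

      follow-passed : ∀ {U s σ ρ t} → (U , s) ∈ₗ D → Reached σ U → Check v U s go →
        (∀ a i' → _—[_]→_ L₂ s a i' → ∃ λ U' → Succ U a U' × (U' , i') ⋐ D) →
        Impl.Path s ρ t → Matched v (σ ++ ρ) t
      follow-passed {U} {σ = σ} m reached passed _ Impl.nil =
        inj₂ (U , nonempty m , subst (λ ρ → Reached ρ U) (sym (++-identityʳ σ)) reached , passed)
      follow-passed m reached _ matched (Impl.τ-step e p) with matched τ _ e
      ... | _ , refl , cov with find cov
      ... | _ , m' , refl , U'⊆U = follow m' (λ s∈ → reached (U'⊆U s∈)) p
      follow-passed {σ = σ} m reached _ matched (Impl.act-step {a = a} {ρ = ρ} e p) with matched (act a) _ e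
      ... | _ , succ , cov with find cov
      ... | (U'' , _) , m' , refl , U''⊆U' =
        subst (λ ρ' → Matched v ρ' _) (++-assoc σ (a ∷ []) ρ) (follow m' reached' p)
        where
        reached' : Reached (σ ++ a ∷ []) U''
        reached' s∈ with to (succ _) (U''⊆U' s∈)
        ... | s₀ , s₀∈ , s₀⟹s = reached s₀∈ Spec.++ᵖ Spec.weak⇒path s₀⟹s

  simulate : ∀ {v ρ t} → Returns L₁ L₂ v enum true → Impl.Path ι₂ ρ t → Matched v ρ t
  simulate (I , init , run) p with run-certificate [] run (start-invariant init)
  ... | D , cert , start = Simulation.follow cert (start (here refl)) (λ s∈ → Spec.weak⇒path (to (init _) s∈)) p

  reached-trace : ∀ {ρ U} → Nonempty U → Reached ρ U → WeakTrace L₁ ρ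
  reached-trace (s , s∈U) reached = s , Spec.path⇒weak (reached s∈U)

  reached-failure : ∀ {ρ U t X} → Reached ρ U → RefIncl U t → Refusal L₂ t X → Failure L₁ ρ X
  reached-failure reached incl refusal with incl _ refusal
  ... | s , s∈U , stable , refusal₁ = s , Spec.path⇒weak (reached s∈U) , stable , refusal₁

  -- (the divergence case of Matched is impossible for tr and sfr)
  sound : ∀ v → Returns L₁ L₂ v enum true → Refinement v
  sound tr ret ρ (t , w) with simulate ret (Impl.weak⇒path w)
  ... | inj₂ (_ , ne , reached , _) = reached-trace ne reached
  sound sfr ret = failures , traces
    where
    traces : ∀ ρ → WeakTrace L₂ ρ → WeakTrace L₁ ρ
    traces ρ (t , w) with simulate ret (Impl.weak⇒path w)
    ... | inj₂ (_ , ne , reached , _) = reached-trace ne reached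
    failures : ∀ ρ X → Failure L₂ ρ X → Failure L₁ ρ X
    failures ρ X (t , w , stable , refusal) with simulate ret (Impl.weak⇒path w)
    ... | inj₂ (_ , _ , reached , sfr-go h) = reached-failure reached (passes-refusals h stable) refusal
  sound fdr ret = failures , divergences
    where
    divergences : ∀ ρ → Divergence L₂ ρ → Divergence L₁ ρ
    divergences ρ (α , β , refl , t , w , div) with simulate ret (Impl.weak⇒path w)
    ... | inj₁ (_ , α₁ , β₁ , refl , rest) = α₁ , β₁ ++ β , ++-assoc α₁ β₁ β , rest
    ... | inj₂ (_ , _ , _ , fdr-go _ ¬div _) = ⊥-elim (¬div div)
    failures : ∀ ρ X → Failure⊥ L₂ ρ X → Failure⊥ L₁ ρ X
    failures ρ X (inj₁ (t , w , stable , refusal)) with simulate ret (Impl.weak⇒path w)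
    ... | inj₁ (_ , div) = inj₂ div
    ... | inj₂ (_ , _ , reached , fdr-go _ _ h) = inj₁ (reached-failure reached (passes-refusals h stable) refusal)
    failures ρ X (inj₂ div) = inj₂ (divergences ρ div)

  Exact : List (Fin k) → Subset n₁ → Set
  Exact ρ U = ∀ s → s ∈ U ⇔ Spec.Path ι₁ ρ s

  NoDivBefore : List (Fin k) → Set
  NoDivBefore ρ = ∀ ρ' a σ → ρ ≡ ρ' ++ a ∷ σ → ∀ t → Spec.Path ι₁ ρ' t → ¬ Diverges L₁ t

  -- the traces a variant explores: Refines_fdr never looks past a divergent spec set
  Explored : Variant → List (Fin k) → Set
  Explored tr _ = ⊤
  Explored sfr _ = ⊤
  Explored fdr ρ = NoDivBefore ρ

  explored-[] : ∀ v → Explored v []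
  explored-[] tr = tt
  explored-[] sfr = tt
  explored-[] fdr [] _ _ ()
  explored-[] fdr (_ ∷ _) _ _ ()

  Explained : Variant → Pair → Set
  Explained v (U , i) = ∃ λ ρ → Exact ρ U × Impl.Path ι₂ ρ i × Explored v ρ

  divergence-at : ∀ {ρ} → Divergence L₁ ρ → NoDivBefore ρ → ∃ λ t → Spec.Path ι₁ ρ t × Diverges L₁ t
  divergence-at (α , [] , refl , t , w , div) _ =
    t , subst (λ ρ → Spec.Path ι₁ ρ t) (sym (++-identityʳ α)) (Spec.weak⇒path w) , div
  divergence-at (α , b ∷ β , eq , t , w , div) nd = ⊥-elim (nd α b β eq t (Spec.weak⇒path w) div)

  no-div-extend : ∀ {ρ a} → NoDivBefore ρ → (∀ t → Spec.Path ι₁ ρ t → ¬ Diverges L₁ t) →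
    NoDivBefore (ρ ++ a ∷ [])
  no-div-extend {ρ} {a} nd here-ok ρ' b σ eq t p div with snoc-split ρ ρ' a b σ eq
  ... | inj₁ refl = here-ok t p div
  ... | inj₂ (σ' , eq') = nd ρ' b σ' eq' t p div

  explored-trace : ∀ v → Refinement v → ∀ {ρ i} → Impl.Path ι₂ ρ i → Explored v ρ → ∃ λ s → Spec.Path ι₁ ρ s
  explored-trace tr ref {ρ} {i} p _ = let (s , w) = ref ρ (i , Impl.path⇒weak p) in s , Spec.weak⇒path w
  explored-trace sfr ref {ρ} {i} p _ = let (s , w) = proj₂ ref ρ (i , Impl.path⇒weak p) in s , Spec.weak⇒path w
  explored-trace fdr ref {ρ} {i} p nd with Impl.stable-or-diverges i
  ... | inj₂ div = via-divergence (proj₂ ref ρ (ρ , [] , sym (++-identityʳ ρ) , i , Impl.path⇒weak p , div))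
    where
    via-divergence : Divergence L₁ ρ → ∃ λ s → Spec.Path ι₁ ρ s
    via-divergence d = let (t , q , _) = divergence-at d nd in t , q
  ... | inj₁ (t , q , stable) with proj₁ ref ρ ∅ (inj₁ (t , Impl.path⇒weak p+q , stable , λ a a∈∅ → ⊥-elim (∉⊥ a∈∅)))
    where
    p+q : Impl.Path ι₂ ρ t
    p+q = subst (λ ρ' → Impl.Path ι₂ ρ' t) (++-identityʳ ρ) (p Impl.++ᵖ q)
  ...   | inj₁ (s , w , _) = s , Spec.weak⇒path w
  ...   | inj₂ d = let (s , q' , _) = divergence-at d nd in s , q'

  sfr-refusals : ∀ {ρ U i} → L₁ ⊑sfr L₂ → Exact ρ U → Impl.Path ι₂ ρ i → Stable L₂ i → RefIncl U i
  sfr-refusals {ρ} ref ex p stable X refusal with proj₁ ref ρ X (_ , Impl.path⇒weak p , stable , refusal)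
  ... | s , w , stable₁ , refusal₁ = s , from (ex s) (Spec.weak⇒path w) , stable₁ , refusal₁

  fdr-refusals : ∀ {ρ U i} → L₁ ⊑fdr L₂ → Exact ρ U → Impl.Path ι₂ ρ i → NoDivBefore ρ →
    ¬ DivergesSet L₁ U → Stable L₂ i → RefIncl U i
  fdr-refusals {ρ} ref ex p nd ¬div stable X refusal with proj₁ ref ρ X (inj₁ (_ , Impl.path⇒weak p , stable , refusal))
  ... | inj₁ (s , w , stable₁ , refusal₁) = s , from (ex s) (Spec.weak⇒path w) , stable₁ , refusal₁
  ... | inj₂ d = let (t , q , div) = divergence-at d nd in ⊥-elim (¬div (t , from (ex t) q , div))

  fdr-no-divergence : ∀ {ρ U i} → L₁ ⊑fdr L₂ → Exact ρ U → Impl.Path ι₂ ρ i → NoDivBefore ρ →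
    ¬ DivergesSet L₁ U → ¬ Diverges L₂ i
  fdr-no-divergence {ρ} ref ex p nd ¬div div
    with divergence-at (proj₂ ref ρ (ρ , [] , sym (++-identityʳ ρ) , _ , Impl.path⇒weak p , div)) nd
  ... | t , q , div₁ = ¬div (t , from (ex t) q , div₁)

  checks-pass : ∀ v → Refinement v → ∀ {ρ U i} → Exact ρ U → Impl.Path ι₂ ρ i → Explored v ρ →
    Check v U i skip ⊎ (Check v U i go × ∀ a → Explored v (ρ ++ a ∷ []))
  checks-pass tr _ _ _ _ = inj₂ (tr-go , λ _ → tt)
  checks-pass sfr ref ex p _ = inj₂ (sfr-go (λ (stable , ¬incl) → ¬incl (sfr-refusals ref ex p stable)) , λ _ → tt)
  checks-pass fdr ref {U = U} ex p nd with Spec.divergesSet? U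
  ... | yes div = inj₁ (fdr-skip div)
  ... | no ¬div = inj₂ (fdr-go ¬div (fdr-no-divergence ref ex p nd ¬div)
                          (λ (stable , ¬incl) → ¬incl (fdr-refusals ref ex p nd ¬div stable)) ,
                        λ _ → no-div-extend nd (λ t q div → ¬div (t , from (ex t) q , div)))

  Successor : Variant → Subset n₁ → Actτ k → Fin n₂ → Set
  Successor v U a i' = ∃ λ U' → Succ U a U' × ¬ U' ≡ ∅ × Explained v (U' , i')

  exact-nonempty : ∀ {ρ U} → Exact ρ U → (∃ λ s → Spec.Path ι₁ ρ s) → ¬ U ≡ ∅
  exact-nonempty ex (s , q) = nonempty⇒≢∅ (s , from (ex s) q)

  successors : ∀ v → Refinement v → ∀ {ρ U i} → Exact ρ U → Impl.Path ι₂ ρ i → Explored v ρ →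
    (∀ a → Explored v (ρ ++ a ∷ [])) → ∀ a i' → _—[_]→_ L₂ i a i' → Successor v U a i'
  successors v ref {ρ} {U} ex p explored _ τ i' e =
    U , refl , exact-nonempty ex (explored-trace v ref p explored) , ρ , ex , p′ , explored
    where
    p′ : Impl.Path ι₂ ρ i'
    p′ = subst (λ ρ' → Impl.Path ι₂ ρ' i') (++-identityʳ ρ) (p Impl.++ᵖ Impl.τ-step e Impl.nil)
  successors v ref {ρ} {U} ex p _ explored-next (act b) i' e =
    Spec.after b U , succ , exact-nonempty ex′ (explored-trace v ref p′ (explored-next b)) ,
    ρ ++ b ∷ [] , ex′ , p′ , explored-next b
    where
    succ : Succ U (act b) (Spec.after b U)
    succ s' = mk⇔ (λ s'∈ → let (s , s∈U , q) = to Spec.∈after s'∈ in s , s∈U , Spec.path⇒weak q)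
                  (λ (s , s∈U , w) → from Spec.∈after (s , s∈U , Spec.weak⇒path w))
    ex′ : Exact (ρ ++ b ∷ []) (Spec.after b U)
    ex′ s' = mk⇔ (λ s'∈ → let (s , s∈U , q) = to Spec.∈after s'∈ in to (ex s) s∈U Spec.++ᵖ q)
                 (λ q → let (u , q₁ , q₂) = Spec.split ρ (b ∷ []) q in from Spec.∈after (u , from (ex u) q₁ , q₂))
    p′ : Impl.Path ι₂ (ρ ++ b ∷ []) i'
    p′ = p Impl.++ᵖ Impl.act-step e Impl.nil

  -- Termination measure: twice the number of pairs not yet covered by the
  -- antichain, plus the stack height.  Each push covers a new pair.

  _⋐?_ : ∀ x A → Dec (x ⋐ A)
  x ⋐? A = Any.any? (λ y → y ≤ₚ? x) A

  allPairs : List Pair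
  allPairs = cartesianProduct (allSubsets n₁) (allFin n₂)

  uncovered : List Pair → ℕ
  uncovered A = count (λ x → ¬? (x ⋐? A)) allPairs

  uncovered-⋓ : ∀ {y A} → ¬ y ⋐ A → uncovered (A ⋓ y) < uncovered A
  uncovered-⋓ {y@(U , i)} {A} y⋐̸A =
    count-strict (λ x → ¬? (x ⋐? (A ⋓ y))) (λ x → ¬? (x ⋐? A)) (λ x⋐̸ x⋐ → x⋐̸ (⋐-⋓ x⋐))
      allPairs (∈-cartesianProduct⁺ (∈-allSubsets U) (∈-allFin i)) (λ y⋐̸ → y⋐̸ (here (≤ₚ-refl y))) y⋐̸A

  measure : List Pair → List Pair → ℕ
  measure W A = uncovered A + uncovered A + length W

  push-measure : ∀ {y W A} → ¬ y ⋐ A → measure (y ∷ W) (A ⋓ y) ≤ measure W A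
  push-measure {y} {W} {A} y⋐̸A rewrite +-suc (uncovered (A ⋓ y) + uncovered (A ⋓ y)) (length W) =
    +-monoˡ-≤ (length W) (+-mono-≤ (uncovered-⋓ y⋐̸A) (<⇒≤ (uncovered-⋓ y⋐̸A)))

  pop-measure : ∀ {x W A f} → measure (x ∷ W) A < suc f → measure W A < f
  pop-measure {x} {W} {A} {f} lt = subst (_≤ f) (+-suc (uncovered A + uncovered A) (length W)) (≤-pred lt)

  build-loop : ∀ {v U i} → (∀ a i' → _—[_]→_ L₂ i a i' → Successor v U a i') →
    (ts : List (Actτ k × Fin n₂)) → (∀ {a i'} → (a , i') ∈ₗ ts → _—[_]→_ L₂ i a i') →
    ∀ W A → (∀ {x} → x ∈ₗ W → Explained v x) →
    ∃ λ W' → ∃ λ A' → ForLoop U ts W A (continue W' A') × (∀ {x} → x ∈ₗ W' → Explained v x) ×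
      measure W' A' ≤ measure W A
  build-loop succs [] _ W A expl = W , A , for-end , expl , ≤-refl
  build-loop succs ((a , i') ∷ ts) steps W A expl with succs a i' (steps (here refl))
  ... | U' , succ , U'≢∅ , expl' with (U' , i') ⋐? A
  ...   | yes covered with build-loop succs ts (λ m → steps (there m)) W A expl
  ...     | W' , A' , loop , expl'' , le = W' , A' , for-old succ U'≢∅ covered loop , expl'' , le
  build-loop succs ((a , i') ∷ ts) steps W A expl | U' , succ , U'≢∅ , expl' | no new
    with build-loop succs ts (λ m → steps (there m)) ((U' , i') ∷ W) (A ⋓ (U' , i'))
           (λ { (here refl) → expl' ; (there m) → expl m })
  ...     | W' , A' , loop , expl'' , le =
    W' , A' , for-new succ U'≢∅ new loop , expl'' , ≤-trans le (push-measure {W = W} new)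

  build-run : ∀ v → Refinement v → (fuel : ℕ) → ∀ W A → measure W A < fuel →
    (∀ {x} → x ∈ₗ W → Explained v x) → Run v enum W A true
  build-run v ref zero W A () _
  build-run v ref (suc f) [] A _ _ = run-done
  build-run v ref (suc f) ((U , i) ∷ W) A lt expl with expl (here refl)
  ... | ρ , ex , p , explored with checks-pass v ref ex p explored
  ...   | inj₁ skipped = run-skip skipped (build-run v ref f W A (pop-measure {U , i} {W} {A} lt) (λ m → expl (there m)))
  ...   | inj₂ (passed , explored-next)
    with build-loop (successors v ref ex p explored explored-next) (enum i) (λ m → to (proj₂ (valid i) _ _) m)
                    W A (λ m → expl (there m))
  ...     | W' , A' , loop , expl' , le =
    run-loop passed loop (build-run v ref f W' A' (≤-trans (s≤s le) (pop-measure {U , i} {W} {A} lt)) expl')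

  complete : ∀ v → Refinement v → Returns L₁ L₂ v enum true
  complete v ref = Spec.initial , init , build-run v ref _ start start ≤-refl
    (λ { (here refl) → [] , (λ s → Spec.∈initial) , Impl.nil , explored-[] v })
    where
    start : List Pair
    start = (Spec.initial , ι₂) ∷ []
    init : IsInit Spec.initial
    init s = mk⇔ (λ s∈ → Spec.path⇒weak (to Spec.∈initial s∈)) (λ w → from Spec.∈initial (Spec.weak⇒path w))

theorem5p2 : ∀ {k} (L₁ L₂ : LTS k) (enum : Algorithm.Enumeration L₁ L₂) →
    ValidEnumeration L₁ L₂ enum →
    (Returns L₁ L₂ tr enum true ⇔ _⊑tr_ L₁ L₂) ×
    (Returns L₁ L₂ sfr enum true ⇔ _⊑sfr_ L₁ L₂) ×
    (Returns L₁ L₂ fdr enum true ⇔ _⊑fdr_ L₁ L₂)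
theorem5p2 L₁ L₂ enum valid = decides tr , decides sfr , decides fdr
  where
  open Correctness L₁ L₂ enum valid using (Refinement; sound; complete)
  decides : ∀ v → Returns L₁ L₂ v enum true ⇔ Refinement v
  decides v = mk⇔ (sound v) (complete v)
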